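{- Let $F$ be a set of facilities with capacities, $C$ a set of clients, $d$ a metric on $F\cup C$, and let $d_\ell$ be the $\ell$-centered metric obtained from $d$ and a set $A\subseteq F$ of at most $\ell$ facilities by the construction described in the context. Then for every assignment $\phi:C\to F$ (in particular any solution computed for the instance with metric $d_\ell$), \[\sum_{c\in C} d_\ell(c,\phi(c)) \ge \sum_{c\in C} d(c,\phi(c)).\]
   Context: Construction of $d_\ell$: for each $f\in A$ create a new vertex (center) $s^f$ at distance $0$ from $f$, extending $d$ to $F\cup C\cup S$ where $S=\{s^f: f\in A\}$. Build a weighted graph on $F\cup C\cup S$: $S$ forms a complete graph with edge lengths given by $d$, and each $v\in F\cup C$ is joined by a single edge to a center $s^v\in S$ closest to $v$ (in the extended $d$), of length $d(v,s^v)$. $d_\ell$ is the shortest-path metric of this graph.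
   Formalization: The metric $d$ on $F\cup C$ takes rational values, and so does $d_\ell$. -}

module Defs where

open import Data.Nat using (ℕ; zero; suc)
open import Data.Fin using (Fin)
open import Data.Fin.Subset using (Subset; _∈_)
open import Data.Sum using (_⊎_; inj₁; inj₂)
open import Data.Product using (Σ; _×_; proj₁)
open import Data.Rational using (ℚ; 0ℚ; _+_; _≤_)
open import Relation.Binary.PropositionalEquality using (_≡_)

sumFin : (n : ℕ) → (Fin n → ℚ) → ℚ
sumFin zero    f = 0ℚ
sumFin (suc n) f = f Fin.zero + sumFin n (λ i → f (Fin.suc i))

Point : ℕ → ℕ → Set
Point nF nC = Fin nF ⊎ Fin nC

record IsMetric {X : Set} (d : X → X → ℚ) : Set where
  field
    nonneg  : ∀ x y → 0ℚ ≤ d x y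
    zero-eq : ∀ x → d x x ≡ 0ℚ
    separ   : ∀ x y → d x y ≡ 0ℚ → x ≡ y
    symm    : ∀ x y → d x y ≡ d y x
    triangle : ∀ x y z → d x z ≤ d x y + d y z

module Construction (nF nC : ℕ) (d : Point nF nC → Point nF nC → ℚ)
                    (A : Subset nF) where

  Center : Set
  Center = Σ (Fin nF) (λ f → f ∈ A)

  Node : Set
  Node = Point nF nC ⊎ Center

  -- s^f is a copy of f (at distance 0 from f).
  base : Node → Point nF nC
  base (inj₁ v) = v
  base (inj₂ s) = inj₁ (proj₁ s)

  dext : Node → Node → ℚ
  dext u w = d (base u) (base w)

  IsClosestCenter : (Point nF nC → Center) → Set
  IsClosestCenter σ = ∀ v (s : Center) → dext (inj₁ v) (inj₂ (σ v)) ≤ dext (inj₁ v) (inj₂ s)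

  data Edge (σ : Point nF nC → Center) : Node → Node → Set where
    center-center : ∀ (s t : Center) → Edge σ (inj₂ s) (inj₂ t)
    to-center     : ∀ v → Edge σ (inj₁ v) (inj₂ (σ v))
    from-center   : ∀ v → Edge σ (inj₂ (σ v)) (inj₁ v)

  data Walk (σ : Point nF nC → Center) : Node → Node → Set where
    []  : ∀ {u} → Walk σ u u
    _∷_ : ∀ {u v w} → Edge σ u v → Walk σ v w → Walk σ u w

  walkLength : ∀ {σ u w} → Walk σ u w → ℚ
  walkLength []                  = 0ℚ
  walkLength (_∷_ {u} {v} e p)   = dext u v + walkLength p

  IsShortestPathMetric : (Point nF nC → Center) → (Node → Node → ℚ) → Set
  IsShortestPathMetric σ dℓ =
    ∀ u w → Σ (Walk σ u w) (λ p → walkLength p ≡ dℓ u w)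
          × (∀ (p : Walk σ u w) → dℓ u w ≤ walkLength p)

-- Every edge {u, w} of the ℓ-centered graph has length d(base u, base w),
-- where base sends a center s^f back to its facility f.  By the triangle
-- inequality for d, the length of any walk from u to w is at least
-- d(base u, base w) (induction on the walk).  Since dℓ u w is realised by
-- some walk, d(base u, base w) ≤ dℓ u w for every pair of nodes; in
-- particular d(c, φ c) ≤ dℓ(c, φ c) for every client c.  Summing these
-- pointwise inequalities over the clients (monotonicity of finite sums)
-- gives the theorem.
module Submission where

open import Defs
open import Data.Nat using (ℕ; _≤_; zero; suc)
open import Data.Fin using (Fin)
open import Data.Fin.Subset using (Subset; ∣_∣)
open import Data.Sum using (inj₁; inj₂)
open import Data.Product using (_,_)
open import Data.Rational using (ℚ) renaming (_≤_ to _≤ℚ_)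
open import Data.Rational.Properties as ℚP using ()
open import Relation.Binary.PropositionalEquality using (subst)

sumFin-mono : ∀ n {f g : Fin n → ℚ} →
              (∀ i → f i ≤ℚ g i) → sumFin n f ≤ℚ sumFin n g
sumFin-mono zero    f≤g = ℚP.≤-refl
sumFin-mono (suc n) f≤g =
  ℚP.+-mono-≤ (f≤g Fin.zero) (sumFin-mono n (λ i → f≤g (Fin.suc i)))

module _ {nF nC : ℕ} {d : Point nF nC → Point nF nC → ℚ} (metric : IsMetric d)
         {A : Subset nF} where
  open Construction nF nC d A
  open IsMetric metric

  walk-dominates : ∀ {σ u w} (p : Walk σ u w) → d (base u) (base w) ≤ℚ walkLength p
  walk-dominates {u = u} [] = ℚP.≤-reflexive (zero-eq (base u))
  walk-dominates {u = u} {w} (_∷_ {v = v} _ p) =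
    ℚP.≤-trans (triangle (base u) (base v) (base w))
               (ℚP.+-monoʳ-≤ (d (base u) (base v)) (walk-dominates p))

  shortestPath-dominates : ∀ {σ dℓ} → IsShortestPathMetric σ dℓ →
                           ∀ u w → d (base u) (base w) ≤ℚ dℓ u w
  shortestPath-dominates shortest u w with shortest u w
  ... | (p , length≡dℓ) , _ =
    subst (d (base u) (base w) ≤ℚ_) length≡dℓ (walk-dominates p)

lemma3 : (nF nC : ℕ) (cap : Fin nF → ℕ)
         (d : Point nF nC → Point nF nC → ℚ) → IsMetric d →
         (ℓ : ℕ) (A : Subset nF) → ∣ A ∣ ≤ ℓ →
         (σ : Point nF nC → Construction.Center nF nC d A) →
         Construction.IsClosestCenter nF nC d A σ →
         (dℓ : Construction.Node nF nC d A → Construction.Node nF nC d A → ℚ) →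
         Construction.IsShortestPathMetric nF nC d A σ dℓ →
         (φ : Fin nC → Fin nF) →
         sumFin nC (λ c → d (inj₂ c) (inj₁ (φ c)))
           ≤ℚ sumFin nC (λ c → dℓ (inj₁ (inj₂ c)) (inj₁ (inj₁ (φ c))))
lemma3 nF nC _ d metric _ A _ _ _ _ shortest φ =
  sumFin-mono nC (λ c →
    shortestPath-dominates metric shortest (inj₁ (inj₂ c)) (inj₁ (inj₁ (φ c))))
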